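{- Each of the complete multipartite graphs $K_{3,3,3}$, $K_{2,4,4}$, $K_{2,3,5}$, $K_{2,2,9}$, $K_{1,2,2,2}$, $K_{1,1,2,3}$, $K_{1,1,1,2,2}$, $K_{1*4,6}$, $K_{1*5,5}$ and $K_{1*6,4}$ is uniquely $3$-list colorable.
   Context: $K_{n_1,\dots,n_r}$ denotes the complete $r$-partite graph with parts of sizes $n_1,\dots,n_r$. The notation $K_{1*r,s}$ denotes the complete $(r+1)$-partite graph with $r$ parts of size $1$ and one part of size $s$. Given a graph $G$ and a list $L(v)$ of colors assigned to each vertex $v$, an $L$-coloring is a proper vertex coloring $c$ of $G$ with $c(v)\in L(v)$ for every vertex $v$. A graph $G$ is uniquely $k$-list colorable if there exist lists $L(v)$, each consisting of exactly $k$ colors, such that $G$ has exactly one $L$-coloring. -}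

module Defs where

open import Data.Nat using (ℕ)
open import Data.Fin using (Fin)
open import Data.List using (List; length; lookup; replicate; _++_; [_])
open import Data.List.Membership.Propositional using (_∈_)
open import Data.List.Relation.Unary.Unique.Propositional using (Unique)
open import Data.Product using (Σ; ∃; _×_)
open import Relation.Binary.PropositionalEquality using (_≡_; _≢_)

record Graph : Set₁ where
  field
    V   : Set
    Adj : V → V → Set
open Graph public

CompleteMultipartite : List ℕ → Graph
CompleteMultipartite ns = record
  { V   = Σ (Fin (length ns)) (λ i → Fin (lookup ns i))
  ; Adj = λ u v → Σ.proj₁ u ≢ Σ.proj₁ v
  }

K1* : ℕ → ℕ → List ℕ
K1* r s = replicate r 1 ++ [ s ]

ListAssignment : Graph → Set
ListAssignment G = V G → List ℕ

IsKAssignment : (G : Graph) → ℕ → ListAssignment G → Set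
IsKAssignment G k L = (v : V G) → Unique (L v) × length (L v) ≡ k

IsLColoring : (G : Graph) → ListAssignment G → (V G → ℕ) → Set
IsLColoring G L c =
  ((v : V G) → c v ∈ L v) × ((u v : V G) → Adj G u v → c u ≢ c v)

HasUniqueLColoring : (G : Graph) → ListAssignment G → Set
HasUniqueLColoring G L =
  Σ (V G → ℕ) λ c → IsLColoring G L c ×
    ((c' : V G → ℕ) → IsLColoring G L c' → (v : V G) → c' v ≡ c v)

UniquelyListColorable : ℕ → Graph → Set
UniquelyListColorable k G =
  Σ (ListAssignment G) λ L → IsKAssignment G k L × HasUniqueLColoring G L

{-# OPTIONS --safe #-}
module Submission where

-- Each graph is given an explicit 3-list assignment L together with an
-- L-coloring c.  Coloring the vertices one at a time, each time with a color of
-- its list not already used on a colored neighbour, reaches every L-coloring of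
-- a finite graph; for these assignments that search has exactly one leaf, so
-- every L-coloring coincides with c.

open import Defs
open import Data.Fin using (zero; suc)
import Data.Fin.Properties as Fin
open import Data.Nat using (ℕ; _≟_)
open import Data.List using (List; []; _∷_; [_]; length; lookup; map; concatMap; filter; allFin)
open import Data.List.Properties using (∷-injectiveˡ; ∷-injectiveʳ)
open import Data.List.Relation.Unary.All as All using (All; []; _∷_; all?)
import Data.List.Relation.Unary.All.Properties as All
open import Data.List.Relation.Unary.Any using (here; there)
open import Data.List.Membership.Propositional using (_∈_)
open import Data.List.Membership.Propositional.Properties
  using (∈-map⁺; ∈-concat⁺′; ∈-filter⁺; ∈-allFin)
open import Data.List.Membership.DecPropositional _≟_ using (_∈?_)
open import Data.List.Relation.Unary.Unique.DecPropositional _≟_ using (unique?)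
open import Data.Product using (_×_; _,_; proj₁; proj₂)
open import Data.Unit using (⊤; tt)
open import Data.Vec as Vec using (Vec; []; _∷_)
open import Function using (_∘′_)
open import Relation.Nullary using (Dec; ¬_; ¬?)
open import Relation.Nullary.Decidable using (True; toWitness; map′; _×-dec_; _→-dec_)
open import Relation.Unary using (Decidable)
open import Relation.Binary.PropositionalEquality using (_≡_; refl; cong)

∀-dec : {A : Set} (xs : List A) → (∀ x → x ∈ xs) →
        {P : A → Set} → Decidable P → Dec (∀ x → P x)
∀-dec xs ∈-xs P? =
  map′ (λ all x → All.lookup all (∈-xs x)) (λ f → All.tabulate (λ {x} _ → f x)) (all? P? xs)

∈-length≡1⇒≡ : {A : Set} {xs : List A} {a b : A} →
               length xs ≡ 1 → a ∈ xs → b ∈ xs → a ≡ b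
∈-length≡1⇒≡ {xs = _ ∷ []} _ (here refl) (here refl) = refl
∈-length≡1⇒≡ {xs = _ ∷ _ ∷ _} () _ _

graphOf : {A B : Set} → (A → B) → List A → List (A × B)
graphOf f = map (λ x → x , f x)

graphOf-injective : {A B : Set} {f g : A → B} (xs : List A) →
                    graphOf f xs ≡ graphOf g xs → ∀ {x} → x ∈ xs → f x ≡ g x
graphOf-injective (_ ∷ _)  eq (here refl) = cong proj₂ (∷-injectiveˡ eq)
graphOf-injective (_ ∷ xs) eq (there x∈)  = graphOf-injective xs (∷-injectiveʳ eq) x∈

module ListColoringSearch
  (G : Graph) (vertices : List (V G)) (∈-vertices : ∀ v → v ∈ vertices)
  (adj? : ∀ u v → Dec (Adj G u v)) (L : ListAssignment G)
  where

  PartialColoring : Set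
  PartialColoring = List (V G × ℕ)

  Clashes : V G → ℕ → V G × ℕ → Set
  Clashes v k (u , l) = Adj G u v × l ≡ k

  Admissible : PartialColoring → V G → ℕ → Set
  Admissible p v k = All (¬_ ∘′ Clashes v k) p

  admissible? : ∀ p v → Decidable (Admissible p v)
  admissible? p v k = all? (λ (u , l) → ¬? (adj? u v ×-dec l ≟ k)) p

  colorings : List (V G) → List PartialColoring
  colorings []       = [ [] ]
  colorings (v ∷ vs) =
    concatMap (λ p → map (λ k → (v , k) ∷ p) (filter (admissible? p v) (L v))) (colorings vs)

  module _ {c : V G → ℕ} (col : IsLColoring G L c) where

    admissible-graphOf : ∀ v vs → Admissible (graphOf c vs) v (c v)
    admissible-graphOf v vs =
      All.map⁺ (All.tabulate (λ {u} _ (adj , eq) → proj₂ col u v adj eq))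

    graphOf-∈-colorings : ∀ vs → graphOf c vs ∈ colorings vs
    graphOf-∈-colorings []       = here refl
    graphOf-∈-colorings (v ∷ vs) =
      ∈-concat⁺′ (∈-map⁺ (λ k → (v , k) ∷ p)
                   (∈-filter⁺ (admissible? p v) (proj₁ col v) (admissible-graphOf v vs)))
                 (∈-map⁺ _ (graphOf-∈-colorings vs))
      where p = graphOf c vs

  isKAssignment? : ∀ k → Dec (IsKAssignment G k L)
  isKAssignment? k = ∀-dec vertices ∈-vertices λ v → unique? (L v) ×-dec length (L v) ≟ k

  isLColoring? : ∀ c → Dec (IsLColoring G L c)
  isLColoring? c =
    ∀-dec vertices ∈-vertices (λ v → c v ∈? L v) ×-dec
    ∀-dec vertices ∈-vertices λ u → ∀-dec vertices ∈-vertices λ v →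
      adj? u v →-dec ¬? (c u ≟ c v)

  uniquelyListColorable-bySearch :
    ∀ {k} (c : V G → ℕ) → IsKAssignment G k L → IsLColoring G L c →
    length (colorings vertices) ≡ 1 → UniquelyListColorable k G
  uniquelyListColorable-bySearch c isK col single =
    L , isK , c , col , λ c' col' v →
      graphOf-injective vertices
        (∈-length≡1⇒≡ single (graphOf-∈-colorings col' vertices)
                             (graphOf-∈-colorings col vertices))
        (∈-vertices v)

MultipartiteVertex : List ℕ → Set
MultipartiteVertex ns = V (CompleteMultipartite ns)

multipartiteVertices : ∀ ns → List (MultipartiteVertex ns)
multipartiteVertices ns =
  concatMap (λ i → map (i ,_) (allFin (lookup ns i))) (allFin (length ns))

∈-multipartiteVertices : ∀ ns v → v ∈ multipartiteVertices ns
∈-multipartiteVertices ns (i , j) =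
  ∈-concat⁺′ (∈-map⁺ (i ,_) (∈-allFin j)) (∈-map⁺ _ (∈-allFin i))

multipartiteAdj? : ∀ ns (u v : MultipartiteVertex ns) →
                   Dec (Adj (CompleteMultipartite ns) u v)
multipartiteAdj? ns (i , _) (i' , _) = ¬? (i Fin.≟ i')

Table : Set → List ℕ → Set
Table A []       = ⊤
Table A (n ∷ ns) = Vec A n × Table A ns

entry : {A : Set} (ns : List ℕ) → Table A ns → MultipartiteVertex ns → A
entry (_ ∷ _)  (row , _)  (zero  , j) = Vec.lookup row j
entry (_ ∷ ns) (_ , rows) (suc i , j) = entry ns rows (i , j)

module MultipartiteSearch (ns : List ℕ) (lists : Table (List ℕ) ns) =
  ListColoringSearch (CompleteMultipartite ns) (multipartiteVertices ns)
    (∈-multipartiteVertices ns) (multipartiteAdj? ns) (entry ns lists)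

multipartite-bySearch :
  ∀ {k} ns (lists : Table (List ℕ) ns) (coloring : Table ℕ ns) →
  let open MultipartiteSearch ns lists in
  {_ : True (isKAssignment? k)} {_ : True (isLColoring? (entry ns coloring))}
  {_ : True (length (colorings (multipartiteVertices ns)) ≟ 1)} →
  UniquelyListColorable k (CompleteMultipartite ns)
multipartite-bySearch ns lists coloring {isK} {col} {single} =
  uniquelyListColorable-bySearch (entry ns coloring)
    (toWitness isK) (toWitness col) (toWitness single)
  where open MultipartiteSearch ns lists

K₃,₃,₃ : UniquelyListColorable 3 (CompleteMultipartite (3 ∷ 3 ∷ 3 ∷ []))
K₃,₃,₃ = multipartite-bySearch (3 ∷ 3 ∷ 3 ∷ [])
  ( ((2 ∷ 4 ∷ 6 ∷ []) ∷ (3 ∷ 5 ∷ 2 ∷ []) ∷ (6 ∷ 0 ∷ 5 ∷ []) ∷ [])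
  , ((5 ∷ 4 ∷ 6 ∷ []) ∷ (6 ∷ 2 ∷ 3 ∷ []) ∷ (2 ∷ 5 ∷ 0 ∷ []) ∷ [])
  , ((3 ∷ 6 ∷ 2 ∷ []) ∷ (5 ∷ 2 ∷ 6 ∷ []) ∷ (5 ∷ 4 ∷ 0 ∷ []) ∷ []) , tt)
  ( (2 ∷ 2 ∷ 0 ∷ []) , (5 ∷ 3 ∷ 5 ∷ []) , (6 ∷ 6 ∷ 4 ∷ []) , tt)

K₂,₄,₄ : UniquelyListColorable 3 (CompleteMultipartite (2 ∷ 4 ∷ 4 ∷ []))
K₂,₄,₄ = multipartite-bySearch (2 ∷ 4 ∷ 4 ∷ [])
  ( ((2 ∷ 4 ∷ 0 ∷ []) ∷ (5 ∷ 1 ∷ 3 ∷ []) ∷ [])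
  , ((5 ∷ 0 ∷ 4 ∷ []) ∷ (2 ∷ 0 ∷ 1 ∷ []) ∷ (4 ∷ 1 ∷ 2 ∷ []) ∷ (0 ∷ 3 ∷ 2 ∷ []) ∷ [])
  , ((5 ∷ 4 ∷ 2 ∷ []) ∷ (4 ∷ 0 ∷ 5 ∷ []) ∷ (0 ∷ 4 ∷ 3 ∷ []) ∷ (2 ∷ 0 ∷ 1 ∷ []) ∷ []) , tt)
  ( (0 ∷ 3 ∷ []) , (5 ∷ 2 ∷ 2 ∷ 2 ∷ []) , (4 ∷ 4 ∷ 4 ∷ 1 ∷ []) , tt)

K₂,₃,₅ : UniquelyListColorable 3 (CompleteMultipartite (2 ∷ 3 ∷ 5 ∷ []))
K₂,₃,₅ = multipartite-bySearch (2 ∷ 3 ∷ 5 ∷ [])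
  ( ((4 ∷ 5 ∷ 3 ∷ []) ∷ (0 ∷ 1 ∷ 2 ∷ []) ∷ [])
  , ((1 ∷ 0 ∷ 5 ∷ []) ∷ (4 ∷ 0 ∷ 3 ∷ []) ∷ (3 ∷ 4 ∷ 5 ∷ []) ∷ [])
  , ((2 ∷ 5 ∷ 0 ∷ []) ∷ (5 ∷ 3 ∷ 0 ∷ []) ∷ (5 ∷ 1 ∷ 4 ∷ [])
     ∷ (2 ∷ 3 ∷ 4 ∷ []) ∷ (1 ∷ 3 ∷ 0 ∷ []) ∷ []) , tt)
  ( (5 ∷ 2 ∷ []) , (1 ∷ 3 ∷ 3 ∷ []) , (0 ∷ 0 ∷ 4 ∷ 4 ∷ 0 ∷ []) , tt)

K₂,₂,₉ : UniquelyListColorable 3 (CompleteMultipartite (2 ∷ 2 ∷ 9 ∷ []))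
K₂,₂,₉ = multipartite-bySearch (2 ∷ 2 ∷ 9 ∷ [])
  ( ((0 ∷ 1 ∷ 5 ∷ []) ∷ (4 ∷ 3 ∷ 2 ∷ []) ∷ [])
  , ((1 ∷ 4 ∷ 2 ∷ []) ∷ (2 ∷ 5 ∷ 3 ∷ []) ∷ [])
  , ((0 ∷ 2 ∷ 3 ∷ []) ∷ (1 ∷ 2 ∷ 4 ∷ []) ∷ (0 ∷ 4 ∷ 5 ∷ []) ∷ (1 ∷ 3 ∷ 5 ∷ [])
     ∷ (2 ∷ 3 ∷ 5 ∷ []) ∷ (0 ∷ 1 ∷ 3 ∷ []) ∷ (0 ∷ 2 ∷ 4 ∷ [])
     ∷ (1 ∷ 2 ∷ 3 ∷ []) ∷ (2 ∷ 4 ∷ 5 ∷ []) ∷ []) , tt)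
  ( (0 ∷ 2 ∷ []) , (1 ∷ 5 ∷ []) , (3 ∷ 4 ∷ 4 ∷ 3 ∷ 3 ∷ 3 ∷ 4 ∷ 3 ∷ 4 ∷ []) , tt)

K₁,₂,₂,₂ : UniquelyListColorable 3 (CompleteMultipartite (1 ∷ 2 ∷ 2 ∷ 2 ∷ []))
K₁,₂,₂,₂ = multipartite-bySearch (1 ∷ 2 ∷ 2 ∷ 2 ∷ [])
  ( ((4 ∷ 2 ∷ 0 ∷ []) ∷ [])
  , ((4 ∷ 2 ∷ 0 ∷ []) ∷ (1 ∷ 2 ∷ 3 ∷ []) ∷ [])
  , ((0 ∷ 4 ∷ 2 ∷ []) ∷ (1 ∷ 2 ∷ 4 ∷ []) ∷ [])
  , ((2 ∷ 4 ∷ 1 ∷ []) ∷ (3 ∷ 4 ∷ 2 ∷ []) ∷ []) , tt)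
  ( (0 ∷ []) , (2 ∷ 2 ∷ []) , (4 ∷ 4 ∷ []) , (1 ∷ 3 ∷ []) , tt)

K₁,₁,₂,₃ : UniquelyListColorable 3 (CompleteMultipartite (1 ∷ 1 ∷ 2 ∷ 3 ∷ []))
K₁,₁,₂,₃ = multipartite-bySearch (1 ∷ 1 ∷ 2 ∷ 3 ∷ [])
  ( ((2 ∷ 3 ∷ 0 ∷ []) ∷ [])
  , ((2 ∷ 1 ∷ 0 ∷ []) ∷ [])
  , ((3 ∷ 1 ∷ 0 ∷ []) ∷ (2 ∷ 0 ∷ 3 ∷ []) ∷ [])
  , ((1 ∷ 0 ∷ 3 ∷ []) ∷ (3 ∷ 0 ∷ 2 ∷ []) ∷ (1 ∷ 0 ∷ 2 ∷ []) ∷ []) , tt)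
  ( (2 ∷ []) , (1 ∷ []) , (3 ∷ 3 ∷ []) , (0 ∷ 0 ∷ 0 ∷ []) , tt)

K₁,₁,₁,₂,₂ : UniquelyListColorable 3 (CompleteMultipartite (1 ∷ 1 ∷ 1 ∷ 2 ∷ 2 ∷ []))
K₁,₁,₁,₂,₂ = multipartite-bySearch (1 ∷ 1 ∷ 1 ∷ 2 ∷ 2 ∷ [])
  ( ((0 ∷ 2 ∷ 4 ∷ []) ∷ [])
  , ((1 ∷ 3 ∷ 4 ∷ []) ∷ [])
  , ((4 ∷ 2 ∷ 3 ∷ []) ∷ [])
  , ((2 ∷ 1 ∷ 4 ∷ []) ∷ (2 ∷ 3 ∷ 4 ∷ []) ∷ [])
  , ((3 ∷ 0 ∷ 4 ∷ []) ∷ (4 ∷ 1 ∷ 2 ∷ []) ∷ []) , tt)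
  ( (0 ∷ []) , (1 ∷ []) , (3 ∷ []) , (2 ∷ 2 ∷ []) , (4 ∷ 4 ∷ []) , tt)

K₁*₄,₆ : UniquelyListColorable 3 (CompleteMultipartite (K1* 4 6))
K₁*₄,₆ = multipartite-bySearch (K1* 4 6)
  ( ((1 ∷ 0 ∷ 3 ∷ []) ∷ [])
  , ((0 ∷ 4 ∷ 3 ∷ []) ∷ [])
  , ((5 ∷ 2 ∷ 3 ∷ []) ∷ [])
  , ((1 ∷ 5 ∷ 4 ∷ []) ∷ [])
  , ((2 ∷ 4 ∷ 5 ∷ []) ∷ (3 ∷ 5 ∷ 0 ∷ []) ∷ (5 ∷ 0 ∷ 1 ∷ [])
     ∷ (4 ∷ 3 ∷ 2 ∷ []) ∷ (3 ∷ 4 ∷ 1 ∷ []) ∷ (2 ∷ 1 ∷ 0 ∷ []) ∷ []) , tt)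
  ( (1 ∷ []) , (3 ∷ []) , (2 ∷ []) , (5 ∷ []) , (4 ∷ 0 ∷ 0 ∷ 4 ∷ 4 ∷ 0 ∷ []) , tt)

K₁*₅,₅ : UniquelyListColorable 3 (CompleteMultipartite (K1* 5 5))
K₁*₅,₅ = multipartite-bySearch (K1* 5 5)
  ( ((2 ∷ 3 ∷ 0 ∷ []) ∷ [])
  , ((4 ∷ 5 ∷ 1 ∷ []) ∷ [])
  , ((4 ∷ 3 ∷ 6 ∷ []) ∷ [])
  , ((0 ∷ 1 ∷ 4 ∷ []) ∷ [])
  , ((3 ∷ 4 ∷ 2 ∷ []) ∷ [])
  , ((4 ∷ 3 ∷ 6 ∷ []) ∷ (5 ∷ 2 ∷ 0 ∷ []) ∷ (5 ∷ 1 ∷ 3 ∷ [])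
     ∷ (0 ∷ 4 ∷ 2 ∷ []) ∷ (1 ∷ 2 ∷ 6 ∷ []) ∷ []) , tt)
  ( (0 ∷ []) , (5 ∷ []) , (6 ∷ []) , (1 ∷ []) , (4 ∷ [])
  , (3 ∷ 2 ∷ 3 ∷ 2 ∷ 2 ∷ []) , tt)

K₁*₆,₄ : UniquelyListColorable 3 (CompleteMultipartite (K1* 6 4))
K₁*₆,₄ = multipartite-bySearch (K1* 6 4)
  ( ((6 ∷ 2 ∷ 1 ∷ []) ∷ [])
  , ((7 ∷ 4 ∷ 0 ∷ []) ∷ [])
  , ((6 ∷ 7 ∷ 3 ∷ []) ∷ [])
  , ((4 ∷ 2 ∷ 3 ∷ []) ∷ [])
  , ((5 ∷ 3 ∷ 6 ∷ []) ∷ [])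
  , ((1 ∷ 6 ∷ 7 ∷ []) ∷ [])
  , ((7 ∷ 3 ∷ 6 ∷ []) ∷ (2 ∷ 6 ∷ 1 ∷ []) ∷ (2 ∷ 5 ∷ 0 ∷ []) ∷ (5 ∷ 1 ∷ 4 ∷ []) ∷ []) , tt)
  ( (2 ∷ []) , (0 ∷ []) , (7 ∷ []) , (4 ∷ []) , (3 ∷ []) , (1 ∷ [])
  , (6 ∷ 6 ∷ 5 ∷ 5 ∷ []) , tt)

proposition3p4 : All (λ ns → UniquelyListColorable 3 (CompleteMultipartite ns))
                   ((3 ∷ 3 ∷ 3 ∷ []) ∷ (2 ∷ 4 ∷ 4 ∷ []) ∷ (2 ∷ 3 ∷ 5 ∷ []) ∷ (2 ∷ 2 ∷ 9 ∷ [])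
                     ∷ (1 ∷ 2 ∷ 2 ∷ 2 ∷ []) ∷ (1 ∷ 1 ∷ 2 ∷ 3 ∷ []) ∷ (1 ∷ 1 ∷ 1 ∷ 2 ∷ 2 ∷ [])
                     ∷ K1* 4 6 ∷ K1* 5 5 ∷ K1* 6 4 ∷ [])
proposition3p4 =
  K₃,₃,₃ ∷ K₂,₄,₄ ∷ K₂,₃,₅ ∷ K₂,₂,₉
    ∷ K₁,₂,₂,₂ ∷ K₁,₁,₂,₃ ∷ K₁,₁,₁,₂,₂
    ∷ K₁*₄,₆ ∷ K₁*₅,₅ ∷ K₁*₆,₄ ∷ []
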